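{- Let $H=(V,E)$ be a connected hypergraph with $|V|\ge 2$, in which every edge has cardinality at least $2$ and every vertex has degree at least $2$. Then the following are equivalent: (1) $H$ has no cut edges; (2) every pair of distinct elements from $V\cup E$ lie on a common strict closed trail; (3) every pair of distinct vertices lie on a common strict closed trail; (4) every pair of distinct edges lie on a common strict closed trail.
   Context: A hypergraph $H=(V,E)$ consists of a nonempty finite vertex set $V$, a finite edge set $E$, and an incidence function $\psi:E\to 2^V$; edges are identified with their vertex sets (parallel edges allowed); the degree of a vertex is the number of edges containing it. Two distinct vertices are adjacent via $e$ if both lie in $e$; a walk is a sequence $v_0e_1v_1\dots e_kv_k$ with $v_{i-1},v_i$ adjacent via $e_i$; $H$ is connected if any two distinct vertices are joined by a walk. A strict closed trail is a walk $v_0e_1v_1\dots e_kv_k$ with $k\ge2$, $v_0=v_k$, and the edges $e_1,\dots,e_k$ pairwise distinct (vertices may repeat); a vertex (edge) lies on it if it is one of the $v_i$ (one of the $e_i$). For an equivalence class $V'$ of "joined by a walk", the connected component is $(V',\{f\in E:\emptyset\ne f\subseteq V'\})$; $\omega(H)$ is the number of components. $H-e=(V,E\setminus\{e\})$; $e$ is a cut edge if $\omega(H-e)>\omega(H)$. -}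

module Defs where

open import Data.Nat using (ℕ; zero; suc; _+_; _≤_; _<_)
open import Data.Bool using (Bool; true; false)
open import Data.Fin using (Fin; zero; suc; punchIn)
open import Data.List using (List; []; _∷_; length)
open import Data.List.Membership.Propositional using (_∈_)
open import Data.List.Relation.Unary.Unique.Propositional using (Unique)
open import Data.Product using (Σ; ∃; _×_; _,_)
open import Data.Sum using (_⊎_; inj₁; inj₂)
open import Relation.Binary.PropositionalEquality using (_≡_; _≢_)
open import Relation.Nullary using (¬_)

-- A hypergraph with vertex set Fin n and edge set Fin m (parallel edges
-- allowed): the incidence function ψ : E → 2^V, given as a characteristic
-- function. H e v ≡ true means v ∈ ψ(e).
Hypergraph : ℕ → ℕ → Set
Hypergraph n m = Fin m → Fin n → Bool

count : ∀ {k} → (Fin k → Bool) → ℕ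
count {zero} f = 0
count {suc k} f with f zero
... | true  = suc (count (λ i → f (suc i)))
... | false = count (λ i → f (suc i))

edgeSize : ∀ {n m} → Hypergraph n m → Fin m → ℕ
edgeSize H e = count (H e)

degree : ∀ {n m} → Hypergraph n m → Fin n → ℕ
degree H v = count (λ e → H e v)

data Walk {n m} (H : Hypergraph n m) : Fin n → Fin n → Set where
  []   : ∀ {v} → Walk H v v
  step : ∀ {u w v} (e : Fin m) → u ≢ w → H e u ≡ true → H e w ≡ true →
         Walk H w v → Walk H u v

walkEdges : ∀ {n m} {H : Hypergraph n m} {u v} → Walk H u v → List (Fin m)
walkEdges []                   = []
walkEdges (step e _ _ _ w)     = e ∷ walkEdges w

walkVertices : ∀ {n m} {H : Hypergraph n m} {u v} → Walk H u v → List (Fin n)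
walkVertices {u = u} []                     = u ∷ []
walkVertices {u = u} (step e _ _ _ w)       = u ∷ walkVertices w

Connected : ∀ {n m} → Hypergraph n m → Set
Connected {n} H = (u v : Fin n) → u ≢ v → Walk H u v

record StrictClosedTrail {n m} (H : Hypergraph n m) : Set where
  field
    start    : Fin n
    walk     : Walk H start start
    len≥2    : 2 ≤ length (walkEdges walk)
    distinct : Unique (walkEdges walk)

open StrictClosedTrail public

VertexOn : ∀ {n m} {H : Hypergraph n m} → Fin n → StrictClosedTrail H → Set
VertexOn v T = v ∈ walkVertices (walk T)

EdgeOn : ∀ {n m} {H : Hypergraph n m} → Fin m → StrictClosedTrail H → Set
EdgeOn e T = e ∈ walkEdges (walk T)

ElemOn : ∀ {n m} {H : Hypergraph n m} → Fin n ⊎ Fin m → StrictClosedTrail H → Set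
ElemOn (inj₁ v) T = VertexOn v T
ElemOn (inj₂ e) T = EdgeOn e T

-- ω(H) = k : there are exactly k equivalence classes of "joined by a walk"
-- (the trivial walk joins a vertex to itself), witnessed by k pairwise
-- non-joined representatives such that every vertex is joined to one of them.
HasComponents : ∀ {n m} → Hypergraph n m → ℕ → Set
HasComponents {n} H k =
  Σ (Fin k → Fin n) λ r →
    ((i j : Fin k) → Walk H (r i) (r j) → i ≡ j) ×
    ((v : Fin n) → ∃ λ i → Walk H v (r i))

deleteEdge : ∀ {n m} → Hypergraph n (suc m) → Fin (suc m) → Hypergraph n m
deleteEdge H e f = H (punchIn e f)

IsCutEdge : ∀ {n m} → Hypergraph n m → Fin m → Set
IsCutEdge {n} {suc m} H e =
  ∃ λ k → ∃ λ k′ → HasComponents H k × HasComponents (deleteEdge H e) k′ × k < k′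

NoCutEdges : ∀ {n m} → Hypergraph n m → Set
NoCutEdges {n} {m} H = (e : Fin m) → ¬ IsCutEdge H e

-- Removing an edge g creates no new component exactly when g is bypassable: any two of its
-- vertices are joined by a walk avoiding g. A closed trail through two vertices consists of two
-- edge-disjoint walks between them, one of which avoids any given edge; this gives bypasses from (3),
-- and from (4) after stepping into the trail along a second edge at each vertex of g (degree ≥ 2).
-- For (1) ⇒ (2), grow a strict closed trail T along a walk towards the wanted element. When the walk
-- leaves T by an edge h to a new vertex u, a bypass of h from u, cut at its first contact with T,
-- splits T (less h, if h is on T) into two arcs; closing either arc with the bypass and h gives a
-- trail through u and h, and one of the two keeps any prescribed element of T.

module Submission where

open import Defs
open import Data.Nat using (ℕ; _≤_)
open import Data.Fin using (Fin)
open import Data.Sum using (_⊎_)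
open import Data.Product using (_×_; ∃)
open import Function.Bundles using (_⇔_)
open import Relation.Binary.PropositionalEquality using (_≢_)

open import Data.Bool using (Bool; true; false)
import Data.Bool.Properties as Bool
open import Data.Empty using (⊥-elim)
open import Data.Fin using (zero; suc; punchIn; punchOut)
open import Data.Fin.Properties using (_≟_; any?; suc-injective; injective⇒≤; punchIn-punchOut; punchInᵢ≢i)
open import Data.List using (List; []; _∷_; _++_; length; lookup; allFin)
open import Data.List.Membership.Propositional using (_∈_; _∉_)
open import Data.List.Membership.Propositional.Properties using (∈-++⁺ˡ; ∈-++⁺ʳ; ∈-++⁻; ∈-allFin; ∈-lookup)
import Data.List.Membership.DecPropositional as DecMembership
open import Data.List.Relation.Binary.Disjoint.Propositional using (Disjoint)
open import Data.List.Relation.Binary.Subset.Propositional using (_⊆_)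
import Data.List.Relation.Unary.All as All
open import Data.List.Relation.Unary.All.Properties using (++⁻ˡ; ++⁻ʳ; ¬Any⇒All¬)
open import Data.List.Relation.Unary.AllPairs using ([]; _∷_)
import Data.List.Relation.Unary.AllPairs as AllPairs
open import Data.List.Relation.Unary.Any using (here; there)
open import Data.List.Relation.Unary.Unique.Propositional using (Unique)
open import Data.List.Relation.Unary.Unique.Propositional.Properties using (++⁺; Unique[x∷xs]⇒x∉xs)
open import Data.Nat using (zero; suc; z≤n; s≤s)
open import Data.Nat.Properties using (<⇒≱)
open import Data.Product using (Σ; _,_; proj₁; proj₂; uncurry)
open import Data.Sum using (inj₁; inj₂; [_,_]′)
open import Data.Sum.Properties using (inj₁-injective; inj₂-injective)
import Data.Sum as Sum
open import Function using (_∘_)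
open import Function.Bundles using (mk⇔)
open import Relation.Binary.PropositionalEquality using (_≡_; refl; sym; cong; subst)
open import Relation.Nullary using (¬_; Dec; yes; no)
open import Relation.Nullary.Decidable using (¬?; _×-dec_)

module _ {A : Set} where

  Unique-++⁻ˡ : ∀ xs {ys : List A} → Unique (xs ++ ys) → Unique xs
  Unique-++⁻ˡ []       _        = []
  Unique-++⁻ˡ (x ∷ xs) (x∉ ∷ u) = ++⁻ˡ xs x∉ ∷ Unique-++⁻ˡ xs u

  Unique-++⁻ʳ : ∀ xs {ys : List A} → Unique (xs ++ ys) → Unique ys
  Unique-++⁻ʳ []       u       = u
  Unique-++⁻ʳ (x ∷ xs) (_ ∷ u) = Unique-++⁻ʳ xs u

  Unique-++⇒Disjoint : ∀ xs {ys : List A} → Unique (xs ++ ys) → Disjoint xs ys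
  Unique-++⇒Disjoint (x ∷ xs) (x∉ ∷ _) (here refl , y∈)   = All.lookup (++⁻ʳ xs x∉) y∈ refl
  Unique-++⇒Disjoint (x ∷ xs) (_ ∷ u)  (there y∈xs , y∈) = Unique-++⇒Disjoint xs u (y∈xs , y∈)

  Unique-++-comm : ∀ xs {ys : List A} → Unique (xs ++ ys) → Unique (ys ++ xs)
  Unique-++-comm xs u =
    ++⁺ (Unique-++⁻ʳ xs u) (Unique-++⁻ˡ xs u) (λ (p , q) → Unique-++⇒Disjoint xs u (q , p))

  Unique-∷ : ∀ {x : A} {xs} → x ∉ xs → Unique xs → Unique (x ∷ xs)
  Unique-∷ {xs = xs} x∉ u = ¬Any⇒All¬ xs x∉ ∷ u

  lookup-injective : ∀ {xs : List A} → Unique xs → ∀ {i j} → lookup xs i ≡ lookup xs j → i ≡ j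
  lookup-injective (_ ∷ _)  {zero}  {zero}  _  = refl
  lookup-injective (x∉ ∷ _) {zero}  {suc j} eq = ⊥-elim (All.lookup x∉ (∈-lookup j) eq)
  lookup-injective (x∉ ∷ _) {suc i} {zero}  eq = ⊥-elim (All.lookup x∉ (∈-lookup i) (sym eq))
  lookup-injective (_ ∷ u)  {suc i} {suc j} eq = cong suc (lookup-injective u eq)

Unique⇒length≤ : ∀ {k} {xs : List (Fin k)} → Unique xs → length xs ≤ k
Unique⇒length≤ {xs = xs} u = injective⇒≤ {f = lookup xs} (lookup-injective u)

distinct⇒2≤ : ∀ {k} (i j : Fin k) → i ≢ j → 2 ≤ k
distinct⇒2≤ {suc zero}    zero zero i≢j = ⊥-elim (i≢j refl)
distinct⇒2≤ {suc (suc _)} _    _    _   = s≤s (s≤s z≤n)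

2≤⇒distinct : ∀ {k} → 2 ≤ k → Σ (Fin k) λ i → Σ (Fin k) λ j → i ≢ j
2≤⇒distinct (s≤s (s≤s _)) = zero , suc zero , λ ()

count≥1⇒witness : ∀ {k} (f : Fin k → Bool) → 1 ≤ count f → ∃ λ i → f i ≡ true
count≥1⇒witness {suc k} f le with f zero in f0
... | true  = zero , f0
... | false with count≥1⇒witness (f ∘ suc) le
...   | i , fi = suc i , fi

count≥2⇒twoWitnesses : ∀ {k} (f : Fin k → Bool) → 2 ≤ count f →
                       ∃ λ i → ∃ λ j → i ≢ j × f i ≡ true × f j ≡ true
count≥2⇒twoWitnesses {suc k} f le with f zero in f0
count≥2⇒twoWitnesses {suc k} f (s≤s le) | true with count≥1⇒witness (f ∘ suc) le
... | j , fj = zero , suc j , (λ ()) , f0 , fj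
count≥2⇒twoWitnesses {suc k} f le | false with count≥2⇒twoWitnesses (f ∘ suc) le
... | i , j , i≢j , fi , fj = suc i , suc j , i≢j ∘ suc-injective , fi , fj

module Walks {n m} (H : Hypergraph n m) where

  infixr 5 _++ʷ_
  _++ʷ_ : ∀ {u w v} → Walk H u w → Walk H w v → Walk H u v
  []               ++ʷ B = B
  step e p hu hw A ++ʷ B = step e p hu hw (A ++ʷ B)

  walkEdges-++ : ∀ {u w v} (A : Walk H u w) (B : Walk H w v) →
                 walkEdges (A ++ʷ B) ≡ walkEdges A ++ walkEdges B
  walkEdges-++ []               B = refl
  walkEdges-++ (step e _ _ _ A) B = cong (e ∷_) (walkEdges-++ A B)

  start∈walkVertices : ∀ {u v} (W : Walk H u v) → u ∈ walkVertices W
  start∈walkVertices []               = here refl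
  start∈walkVertices (step _ _ _ _ _) = here refl

  end∈walkVertices : ∀ {u v} (W : Walk H u v) → v ∈ walkVertices W
  end∈walkVertices []               = here refl
  end∈walkVertices (step _ _ _ _ W) = there (end∈walkVertices W)

  ∈ᵛ-++⁻ : ∀ {u w v x} (A : Walk H u w) (B : Walk H w v) →
           x ∈ walkVertices (A ++ʷ B) → x ∈ walkVertices A ⊎ x ∈ walkVertices B
  ∈ᵛ-++⁻ []               B p           = inj₂ p
  ∈ᵛ-++⁻ (step _ _ _ _ A) B (here refl) = inj₁ (here refl)
  ∈ᵛ-++⁻ (step _ _ _ _ A) B (there p)   = Sum.map₁ there (∈ᵛ-++⁻ A B p)

  ∈ᵛ-++⁺ˡ : ∀ {u w v x} (A : Walk H u w) (B : Walk H w v) →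
            x ∈ walkVertices A → x ∈ walkVertices (A ++ʷ B)
  ∈ᵛ-++⁺ˡ []               B (here refl) = start∈walkVertices B
  ∈ᵛ-++⁺ˡ (step _ _ _ _ A) B (here refl) = here refl
  ∈ᵛ-++⁺ˡ (step _ _ _ _ A) B (there p)   = there (∈ᵛ-++⁺ˡ A B p)

  ∈ᵛ-++⁺ʳ : ∀ {u w v x} (A : Walk H u w) (B : Walk H w v) →
            x ∈ walkVertices B → x ∈ walkVertices (A ++ʷ B)
  ∈ᵛ-++⁺ʳ []               B p = p
  ∈ᵛ-++⁺ʳ (step _ _ _ _ A) B p = there (∈ᵛ-++⁺ʳ A B p)

  module _ {u w v} (A : Walk H u w) (B : Walk H w v) where

    ∈ᵉ-++⁻ : ∀ {e} → e ∈ walkEdges (A ++ʷ B) → e ∈ walkEdges A ⊎ e ∈ walkEdges B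
    ∈ᵉ-++⁻ p = ∈-++⁻ (walkEdges A) (subst (_ ∈_) (walkEdges-++ A B) p)

    ∈ᵉ-++⁺ˡ : ∀ {e} → e ∈ walkEdges A → e ∈ walkEdges (A ++ʷ B)
    ∈ᵉ-++⁺ˡ p = subst (_ ∈_) (sym (walkEdges-++ A B)) (∈-++⁺ˡ p)

    ∈ᵉ-++⁺ʳ : ∀ {e} → e ∈ walkEdges B → e ∈ walkEdges (A ++ʷ B)
    ∈ᵉ-++⁺ʳ p = subst (_ ∈_) (sym (walkEdges-++ A B)) (∈-++⁺ʳ (walkEdges A) p)

  _∈ʷ_ : ∀ {u v} → Fin n ⊎ Fin m → Walk H u v → Set
  inj₁ x ∈ʷ W = x ∈ walkVertices W
  inj₂ e ∈ʷ W = e ∈ walkEdges W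

  ∈ʷ-step⁺ : ∀ {u w v e p hu hw} {W : Walk H w v} x → x ∈ʷ W → x ∈ʷ step {u = u} e p hu hw W
  ∈ʷ-step⁺ (inj₁ _) = there
  ∈ʷ-step⁺ (inj₂ _) = there

  module _ {u w v} (A : Walk H u w) (B : Walk H w v) where

    ∈ʷ-++⁻ : ∀ x → x ∈ʷ (A ++ʷ B) → x ∈ʷ A ⊎ x ∈ʷ B
    ∈ʷ-++⁻ (inj₁ _) = ∈ᵛ-++⁻ A B
    ∈ʷ-++⁻ (inj₂ _) = ∈ᵉ-++⁻ A B

    ∈ʷ-++⁺ˡ : ∀ x → x ∈ʷ A → x ∈ʷ (A ++ʷ B)
    ∈ʷ-++⁺ˡ (inj₁ _) = ∈ᵛ-++⁺ˡ A B
    ∈ʷ-++⁺ˡ (inj₂ _) = ∈ᵉ-++⁺ˡ A B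

    ∈ʷ-++⁺ʳ : ∀ x → x ∈ʷ B → x ∈ʷ (A ++ʷ B)
    ∈ʷ-++⁺ʳ (inj₁ _) = ∈ᵛ-++⁺ʳ A B
    ∈ʷ-++⁺ʳ (inj₂ _) = ∈ᵉ-++⁺ʳ A B

  reverseʷ : ∀ {u v} → Walk H u v → Walk H v u
  reverseʷ []                 = []
  reverseʷ (step e p hu hw A) = reverseʷ A ++ʷ step e (p ∘ sym) hw hu []

  ∈ᵉ-reverse⁻ : ∀ {u v e} (A : Walk H u v) → e ∈ walkEdges (reverseʷ A) → e ∈ walkEdges A
  ∈ᵉ-reverse⁻ (step e p hu hw A) q with ∈ᵉ-++⁻ (reverseʷ A) (step e _ hw hu []) q
  ... | inj₁ r           = there (∈ᵉ-reverse⁻ A r)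
  ... | inj₂ (here refl) = here refl

  IsTrail : ∀ {u v} → Walk H u v → Set
  IsTrail W = Unique (walkEdges W)

  module _ {u w v} (A : Walk H u w) (B : Walk H w v) where

    IsTrail-++⁺ : IsTrail A → IsTrail B → Disjoint (walkEdges A) (walkEdges B) → IsTrail (A ++ʷ B)
    IsTrail-++⁺ tA tB A#B = subst Unique (sym (walkEdges-++ A B)) (++⁺ tA tB A#B)

    private
      edgesUnique : IsTrail (A ++ʷ B) → Unique (walkEdges A ++ walkEdges B)
      edgesUnique = subst Unique (walkEdges-++ A B)

    IsTrail-++⁻ˡ : IsTrail (A ++ʷ B) → IsTrail A
    IsTrail-++⁻ˡ = Unique-++⁻ˡ (walkEdges A) ∘ edgesUnique

    IsTrail-++⁻ʳ : IsTrail (A ++ʷ B) → IsTrail B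
    IsTrail-++⁻ʳ = Unique-++⁻ʳ (walkEdges A) ∘ edgesUnique

    IsTrail-++⇒Disjoint : IsTrail (A ++ʷ B) → Disjoint (walkEdges A) (walkEdges B)
    IsTrail-++⇒Disjoint = Unique-++⇒Disjoint (walkEdges A) ∘ edgesUnique

  IsTrail-++-comm : ∀ {u w} (A : Walk H u w) (B : Walk H w u) → IsTrail (A ++ʷ B) → IsTrail (B ++ʷ A)
  IsTrail-++-comm A B t =
    subst Unique (sym (walkEdges-++ B A)) (Unique-++-comm (walkEdges A) (subst Unique (walkEdges-++ A B) t))

  IsTrail-reverse : ∀ {u v} (A : Walk H u v) → IsTrail A → IsTrail (reverseʷ A)
  IsTrail-reverse []                 _ = []
  IsTrail-reverse (step e p hu hw A) t =
    IsTrail-++⁺ (reverseʷ A) (step e _ hw hu []) (IsTrail-reverse A (AllPairs.tail t)) (All.[] ∷ [])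
      λ { (q , here refl) → Unique[x∷xs]⇒x∉xs t (∈ᵉ-reverse⁻ A q) }

  splitAtVertex : ∀ {u v x} (W : Walk H u v) → x ∈ walkVertices W →
                  Σ (Walk H u x) λ A → Σ (Walk H x v) λ B → W ≡ A ++ʷ B
  splitAtVertex []                 (here refl) = [] , [] , refl
  splitAtVertex (step e p hu hw W) (here refl) = [] , step e p hu hw W , refl
  splitAtVertex (step e p hu hw W) (there q) with splitAtVertex W q
  ... | A , B , refl = step e p hu hw A , B , refl

  record EdgeSplit {u v} (W : Walk H u v) (e : Fin m) : Set where
    constructor edgeSplit
    field
      {c d} : Fin n
      c≢d   : c ≢ d
      ec    : H e c ≡ true
      ed    : H e d ≡ true
      A     : Walk H u c
      B     : Walk H d v
      split : W ≡ A ++ʷ step e c≢d ec ed B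

  splitAtEdge : ∀ {u v e} (W : Walk H u v) → e ∈ walkEdges W → EdgeSplit W e
  splitAtEdge (step e p hu hw W) (here refl) = edgeSplit p hu hw [] W refl
  splitAtEdge (step e p hu hw W) (there q) with splitAtEdge W q
  ... | edgeSplit c≢d ec ed A B refl = edgeSplit c≢d ec ed (step e p hu hw A) B refl

  open DecMembership (_≟_ {n}) public using () renaming (_∈?_ to _∈ᵛ?_)
  open DecMembership (_≟_ {m}) public using () renaming (_∈?_ to _∈ᵉ?_)

  shortenToTrail : ∀ {u v} (W : Walk H u v) →
                   Σ (Walk H u v) λ T → IsTrail T × walkEdges T ⊆ walkEdges W
  shortenToTrail [] = [] , [] , λ ()
  shortenToTrail {u} (step e p hu hw W) with shortenToTrail W
  ... | T , tT , T⊆W with e ∈ᵉ? walkEdges T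
  ... | no e∉T = step e p hu hw T , Unique-∷ e∉T tT ,
                 λ { (here refl) → here refl ; (there q) → there (T⊆W q) }
  ... | yes e∈T with splitAtEdge T e∈T
  ... | edgeSplit {d = d} _ _ ed A B refl with u ≟ d
  ...   | yes refl = B , AllPairs.tail (IsTrail-++⁻ʳ A _ tT) , there ∘ T⊆W ∘ ∈ᵉ-++⁺ʳ A _ ∘ there
  ...   | no u≢d   = step e u≢d hu ed B , IsTrail-++⁻ʳ A _ tT ,
                     λ { (here refl) → here refl ; (there q) → there (T⊆W (∈ᵉ-++⁺ʳ A _ (there q))) }

  walkOfLength? : ∀ L u v → Dec (Σ (Walk H u v) λ W → length (walkEdges W) ≤ L)
  walkOfLength? L u v with u ≟ v
  ... | yes refl = yes ([] , z≤n)
  walkOfLength? zero    u v | no u≢v = no λ { ([] , _) → u≢v refl ; (step _ _ _ _ _ , ()) }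
  walkOfLength? (suc L) u v | no u≢v with any? (λ e → any? (λ w →
                   ¬? (u ≟ w) ×-dec (H e u Bool.≟ true) ×-dec (H e w Bool.≟ true) ×-dec walkOfLength? L w v))
  ...   | yes (e , w , u≢w , eu , ew , W , ≤L) = yes (step e u≢w eu ew W , s≤s ≤L)
  ...   | no ∄ = no λ { ([] , _) → u≢v refl
                       ; (step e u≢w eu ew W , s≤s ≤L) → ∄ (e , _ , u≢w , eu , ew , W , ≤L) }

  -- A trail has at most m edges, so searching walks up to length m suffices.
  walk? : ∀ u v → Dec (Walk H u v)
  walk? u v with walkOfLength? m u v
  ... | yes (W , _) = yes W
  ... | no ∄ = no λ W → let (T , tT , _) = shortenToTrail W in ∄ (T , Unique⇒length≤ tT)

module _ {n m} (G : Hypergraph n m) where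
  open Walks G

  private
    record ComponentsCovering (L : List (Fin n)) : Set where
      constructor components
      field
        {k}            : ℕ
        representative : Fin k → Fin n
        separated      : (i j : Fin k) → Walk G (representative i) (representative j) → i ≡ j
        covers         : ∀ v → v ∈ L → ∃ λ i → Walk G v (representative i)

    componentsCovering : (L : List (Fin n)) → ComponentsCovering L
    componentsCovering [] = components {k = 0} (λ ()) (λ ()) (λ _ ())
    componentsCovering (v ∷ L) with componentsCovering L
    ... | components r sep cov with any? (λ i → walk? v (r i))
    ...   | yes (i , W) = components r sep λ { _ (here refl) → i , W ; x (there x∈L) → cov x x∈L }
    ...   | no ∄ = components r′ sep′ cov′
      where
        r′ : Fin (suc _) → Fin n
        r′ zero    = v
        r′ (suc i) = r i
        sep′ : ∀ i j → Walk G (r′ i) (r′ j) → i ≡ j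
        sep′ zero    zero    _ = refl
        sep′ zero    (suc j) W = ⊥-elim (∄ (j , W))
        sep′ (suc i) zero    W = ⊥-elim (∄ (i , reverseʷ W))
        sep′ (suc i) (suc j) W = cong suc (sep i j W)
        cov′ : ∀ x → x ∈ v ∷ L → ∃ λ i → Walk G x (r′ i)
        cov′ _ (here refl)  = zero , []
        cov′ x (there x∈L) with cov x x∈L
        ... | i , W = suc i , W

  hasComponents : ∃ (HasComponents G)
  hasComponents with componentsCovering (allFin n)
  ... | components r sep cov = _ , r , sep , λ v → cov v (∈-allFin v)

  connected⇒HasComponents1 : Fin n → Connected G → HasComponents G 1
  connected⇒HasComponents1 v₀ conn = (λ _ → v₀) , (λ { zero zero _ → refl }) , λ v → zero , walkTo v
    where
      walkTo : ∀ v → Walk G v v₀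
      walkTo v with v ≟ v₀
      ... | yes refl = []
      ... | no v≢v₀  = conn v v₀ v≢v₀

  HasComponents⇒2≤ : ∀ {k u t} → HasComponents G k → ¬ Walk G u t → 2 ≤ k
  HasComponents⇒2≤ {u = u} {t} (r , sep , cov) ∄ with cov u | cov t
  ... | i , U | j , T = distinct⇒2≤ i j λ { refl → ∄ (U ++ʷ reverseʷ T) }

  -- As walks of G are walks of G′, a representative of G′ is determined by its component in G.
  components-≤ : ∀ {m′} {G′ : Hypergraph n m′} {k k′} → HasComponents G k → HasComponents G′ k′ →
                 (∀ {u v} → Walk G u v → Walk G′ u v) → k′ ≤ k
  components-≤ {k′ = k′} (r , _ , cov) (r′ , sep′ , _) embed = injective⇒≤ {f = component} injective
    where
      component : Fin k′ → Fin _
      component j = proj₁ (cov (r′ j))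
      injective : ∀ {i j} → component i ≡ component j → i ≡ j
      injective {i} {j} eq = sep′ i j (embed (proj₂ (cov (r′ i)) ++ʷ
        reverseʷ (subst (λ c → Walk G (r′ j) (r c)) (sym eq) (proj₂ (cov (r′ j))))))

Bypass : ∀ {n m} → Hypergraph n m → Fin m → Fin n → Fin n → Set
Bypass H g u t = Σ (Walk H u t) λ W → g ∉ walkEdges W

Bypassable : ∀ {n m} → Hypergraph n m → Fin m → Set
Bypassable H g = ∀ {u t} → H g u ≡ true → H g t ≡ true → Bypass H g u t

module Deletion {n m} (H : Hypergraph n (suc m)) (g : Fin (suc m)) where
  open Walks H
  private module H-g = Walks (deleteEdge H g)

  avoiding⇒walk : ∀ {u v} (W : Walk H u v) → g ∉ walkEdges W → Walk (deleteEdge H g) u v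
  avoiding⇒walk [] _ = []
  avoiding⇒walk (step {u = u} {w} e p hu hw W) g∉ =
    step (punchOut g≢e) p (subst (λ f → H f u ≡ true) (sym (punchIn-punchOut g≢e)) hu)
                          (subst (λ f → H f w ≡ true) (sym (punchIn-punchOut g≢e)) hw)
                          (avoiding⇒walk W (g∉ ∘ there))
    where
      g≢e : g ≢ e
      g≢e = g∉ ∘ here

  walk⇒bypass : ∀ {u v} → Walk (deleteEdge H g) u v → Bypass H g u v
  walk⇒bypass [] = [] , λ ()
  walk⇒bypass (step f p hu hw W) with walk⇒bypass W
  ... | W′ , g∉ = step (punchIn g f) p hu hw W′ ,
                  λ { (here eq) → punchInᵢ≢i g f (sym eq) ; (there q) → g∉ q }

  bypassable⇒¬cut : Bypassable H g → ¬ IsCutEdge H g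
  bypassable⇒¬cut bypass (_ , _ , cH , cH-g , k<k′) = <⇒≱ k<k′ (components-≤ H cH cH-g reroute)
    where
      reroute : ∀ {u v} → Walk H u v → Walk (deleteEdge H g) u v
      reroute [] = []
      reroute (step e p hu hw W) with e ≟ g
      ... | yes refl = uncurry avoiding⇒walk (bypass hu hw) H-g.++ʷ reroute W
      ... | no e≢g   = avoiding⇒walk (step e p hu hw []) (λ { (here g≡e) → e≢g (sym g≡e) })
                         H-g.++ʷ reroute W

  ¬cut⇒bypassable : Connected H → ¬ IsCutEdge H g → Bypassable H g
  ¬cut⇒bypassable conn ¬cut {u} {t} _ _ with H-g.walk? u t
  ... | yes W = walk⇒bypass W
  ... | no ∄ with hasComponents (deleteEdge H g)
  ...   | k′ , cH-g =
    ⊥-elim (¬cut (1 , k′ , connected⇒HasComponents1 H u conn , cH-g ,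
                  HasComponents⇒2≤ (deleteEdge H g) cH-g ∄))

noCutEdges⇒bypassable : ∀ {n m} {H : Hypergraph n m} → Connected H → NoCutEdges H → ∀ g → Bypassable H g
noCutEdges⇒bypassable {m = suc _} {H} conn noCut g = Deletion.¬cut⇒bypassable H g conn (noCut g)

bypassable⇒noCutEdges : ∀ {n m} {H : Hypergraph n m} → (∀ g → Bypassable H g) → NoCutEdges H
bypassable⇒noCutEdges {m = suc _} {H} bypass g = Deletion.bypassable⇒¬cut H g (bypass g)

module ClosedTrails {n m} (H : Hypergraph n m) where
  open Walks H

  closeWithEdge : ∀ {u v h} (W : Walk H u v) → IsTrail W → h ∉ walkEdges W →
                  H h u ≡ true → H h v ≡ true → v ≢ u → StrictClosedTrail H
  closeWithEdge {h = h} W tW h∉W hu hv v≢u = record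
    { start    = _
    ; walk     = step h v≢u hv hu W
    ; len≥2    = s≤s (nonempty W)
    ; distinct = Unique-∷ h∉W tW
    }
    where
      nonempty : (W : Walk H _ _) → 1 ≤ length (walkEdges W)
      nonempty []               = ⊥-elim (v≢u refl)
      nonempty (step _ _ _ _ _) = s≤s z≤n

  record ClosedRotation {s t} (W : Walk H s s) : Set where
    field
      R        : Walk H t t
      trail    : IsTrail W → IsTrail R
      elements : ∀ x → x ∈ʷ W → x ∈ʷ R
      edges⊆   : walkEdges R ⊆ walkEdges W

  rotateTo : ∀ {s t} (W : Walk H s s) → t ∈ walkVertices W → ClosedRotation {t = t} W
  rotateTo W t∈W with splitAtVertex W t∈W
  ... | A , B , refl = record
    { R        = B ++ʷ A
    ; trail    = IsTrail-++-comm A B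
    ; elements = λ x → [ ∈ʷ-++⁺ʳ B A x , ∈ʷ-++⁺ˡ B A x ]′ ∘ ∈ʷ-++⁻ A B x
    ; edges⊆   = [ ∈ᵉ-++⁺ʳ A B , ∈ᵉ-++⁺ˡ A B ]′ ∘ ∈ᵉ-++⁻ B A
    }

  record OpenedAt {s} (W : Walk H s s) (h : Fin m) : Set where
    field
      {c d}    : Fin n
      hc       : H h c ≡ true
      hd       : H h d ≡ true
      c∈W      : c ∈ walkVertices W
      d∈W      : d ∈ walkVertices W
      R        : Walk H d c
      trail    : IsTrail R
      h∉R      : h ∉ walkEdges R
      elements : ∀ x → x ∈ʷ W → x ≡ inj₂ h ⊎ x ∈ʷ R

  openAt : ∀ {s h} (W : Walk H s s) → IsTrail W → h ∈ walkEdges W → OpenedAt W h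
  openAt W tW h∈W with splitAtEdge W h∈W
  ... | edgeSplit c≢d hc hd A B refl = record
    { hc       = hc
    ; hd       = hd
    ; c∈W      = ∈ᵛ-++⁺ʳ A S (here refl)
    ; d∈W      = ∈ᵛ-++⁺ʳ A S (there (start∈walkVertices B))
    ; R        = B ++ʷ A
    ; trail    = IsTrail-++⁺ B A (AllPairs.tail tS) (IsTrail-++⁻ˡ A S tW) (λ (p , q) → S#A (q , there p))
    ; h∉R      = [ Unique[x∷xs]⇒x∉xs tS , (λ q → S#A (q , here refl)) ]′ ∘ ∈ᵉ-++⁻ B A
    ; elements = elements
    }
    where
      S  = step _ c≢d hc hd B
      tS = IsTrail-++⁻ʳ A S tW
      S#A : Disjoint (walkEdges A) (walkEdges S)
      S#A = IsTrail-++⇒Disjoint A S tW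
      elements : ∀ x → x ∈ʷ (A ++ʷ S) → x ≡ inj₂ _ ⊎ x ∈ʷ (B ++ʷ A)
      elements x x∈ with ∈ʷ-++⁻ A S x x∈
      elements x        _ | inj₁ x∈A = inj₂ (∈ʷ-++⁺ʳ B A x x∈A)
      elements (inj₁ v) _ | inj₂ (here refl) = inj₂ (∈ᵛ-++⁺ʳ B A (end∈walkVertices A))
      elements (inj₁ v) _ | inj₂ (there v∈B) = inj₂ (∈ᵛ-++⁺ˡ B A v∈B)
      elements (inj₂ e) _ | inj₂ (here refl) = inj₁ refl
      elements (inj₂ e) _ | inj₂ (there e∈B) = inj₂ (∈ᵉ-++⁺ˡ B A e∈B)

  -- The point where a walk first meets R: a vertex of R, or a vertex outside R on an edge of R.
  data Touch {b a} (R : Walk H b a) (q : Fin n) : Set where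
    atVertex : q ∈ walkVertices R → Touch R q
    viaEdge  : ∀ {h′} → h′ ∈ walkEdges R → H h′ q ≡ true → q ∉ walkVertices R → Touch R q

  record TouchSplit {b a} (R : Walk H b a) (q : Fin n) : Set where
    field
      before       : Walk H b q
      after        : Walk H q a
      before-trail : IsTrail before
      after-trail  : IsTrail after
      before⊆      : walkEdges before ⊆ walkEdges R
      after⊆       : walkEdges after ⊆ walkEdges R
      covers       : ∀ x → x ∈ʷ R → x ∈ʷ before ⊎ x ∈ʷ after

  -- In the viaEdge case both halves use the touched edge, but never in the same trail.
  splitAtTouch : ∀ {b a q} (R : Walk H b a) → IsTrail R → Touch R q → TouchSplit R q
  splitAtTouch R tR (atVertex q∈R) with splitAtVertex R q∈R
  ... | A , B , refl = record
    { before       = A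
    ; after        = B
    ; before-trail = IsTrail-++⁻ˡ A B tR
    ; after-trail  = IsTrail-++⁻ʳ A B tR
    ; before⊆      = ∈ᵉ-++⁺ˡ A B
    ; after⊆       = ∈ᵉ-++⁺ʳ A B
    ; covers       = ∈ʷ-++⁻ A B
    }
  splitAtTouch R tR (viaEdge h′∈R h′q q∉R) with splitAtEdge R h′∈R
  ... | edgeSplit c≢d h′c h′d A B refl = record
    { before       = A ++ʷ toQ
    ; after        = fromQ
    ; before-trail = IsTrail-++⁺ A toQ (IsTrail-++⁻ˡ A S tR) (All.[] ∷ [])
                       λ { (p , here refl) → IsTrail-++⇒Disjoint A S tR (p , here refl) }
    ; after-trail  = IsTrail-++⁻ʳ A S tR
    ; before⊆      = [ ∈ᵉ-++⁺ˡ A S , (λ { (here refl) → ∈ᵉ-++⁺ʳ A S (here refl) }) ]′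
                     ∘ ∈ᵉ-++⁻ A toQ
    ; after⊆       = ∈ᵉ-++⁺ʳ A S
    ; covers       = covers
    }
    where
      S     = step _ c≢d h′c h′d B
      c≢q   = λ { refl → q∉R (∈ᵛ-++⁺ʳ A S (here refl)) }
      q≢d   = λ { refl → q∉R (∈ᵛ-++⁺ʳ A S (there (start∈walkVertices B))) }
      toQ   = step _ c≢q h′c h′q []
      fromQ = step _ q≢d h′q h′d B
      covers : ∀ x → x ∈ʷ (A ++ʷ S) → x ∈ʷ (A ++ʷ toQ) ⊎ x ∈ʷ fromQ
      covers x x∈ with ∈ʷ-++⁻ A S x x∈
      covers x        _ | inj₁ x∈A        = inj₁ (∈ʷ-++⁺ˡ A toQ x x∈A)
      covers (inj₁ v) _ | inj₂ (here refl) = inj₁ (∈ᵛ-++⁺ˡ A toQ (end∈walkVertices A))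
      covers (inj₁ v) _ | inj₂ (there p)   = inj₂ (there p)
      covers (inj₂ e) _ | inj₂ p           = inj₂ p

  record FirstTouch {b a u v} (R : Walk H b a) (W : Walk H u v) : Set where
    field
      {q}      : Fin n
      prefix   : Walk H u q
      prefix⊆  : walkEdges prefix ⊆ walkEdges W
      disjoint : Disjoint (walkEdges prefix) (walkEdges R)
      touch    : Touch R q

  firstTouch : ∀ {b a u v} (R : Walk H b a) (W : Walk H u v) → v ∈ walkVertices R → FirstTouch R W
  firstTouch {u = u} R W v∈R with u ∈ᵛ? walkVertices R
  ... | yes u∈R =
    record { prefix = [] ; prefix⊆ = λ () ; disjoint = λ { (() , _) } ; touch = atVertex u∈R }
  firstTouch R [] v∈R | no u∉R = ⊥-elim (u∉R v∈R)
  firstTouch R (step e p hu hw W) v∈R | no u∉R with e ∈ᵉ? walkEdges R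
  ... | yes e∈R =
    record { prefix = [] ; prefix⊆ = λ () ; disjoint = λ { (() , _) } ; touch = viaEdge e∈R hu u∉R }
  ... | no e∉R = record
    { prefix   = step e p hu hw prefix
    ; prefix⊆  = λ { (here refl) → here refl ; (there z) → there (prefix⊆ z) }
    ; disjoint = λ { (here refl , e∈R) → e∉R e∈R ; (there z , z∈R) → disjoint (z , z∈R) }
    ; touch    = touch
    }
    where open FirstTouch (firstTouch R W v∈R)

  TrailThrough : Fin n ⊎ Fin m → Fin n → Fin m → Set
  TrailThrough x u h =
    Σ (StrictClosedTrail H) λ T → x ∈ʷ walk T × u ∈ walkVertices (walk T) × h ∈ walkEdges (walk T)

  attachEar : ∀ {a b u h} → Bypassable H h → (R : Walk H b a) → IsTrail R → h ∉ walkEdges R →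
              H h a ≡ true → H h b ≡ true → H h u ≡ true → u ≢ a → u ≢ b →
              ∀ x → x ≡ inj₂ h ⊎ x ∈ʷ R → TrailThrough x u h
  attachEar {a} {b} {u} {h} bypass R tR h∉R ha hb hu u≢a u≢b = through
    where
      ear = bypass hu ha
      open FirstTouch (firstTouch R (proj₁ ear) (end∈walkVertices R))
      W   = proj₁ (shortenToTrail prefix)
      tW  = proj₁ (proj₂ (shortenToTrail prefix))
      W⊆  = proj₂ (proj₂ (shortenToTrail prefix))
      open TouchSplit (splitAtTouch R tR touch)

      W#R : Disjoint (walkEdges W) (walkEdges R)
      W#R (p , q) = disjoint (W⊆ p , q)
      h∉W : h ∉ walkEdges W
      h∉W = proj₂ ear ∘ prefix⊆ ∘ W⊆

      TA = closeWithEdge (W ++ʷ after)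
             (IsTrail-++⁺ W after tW after-trail λ (p , q) → W#R (p , after⊆ q))
             ([ h∉W , h∉R ∘ after⊆ ]′ ∘ ∈ᵉ-++⁻ W after) hu ha (u≢a ∘ sym)
      TB = closeWithEdge (before ++ʷ reverseʷ W)
             (IsTrail-++⁺ before (reverseʷ W) before-trail (IsTrail-reverse W tW)
               λ (p , q) → W#R (∈ᵉ-reverse⁻ W q , before⊆ p))
             ([ h∉R ∘ before⊆ , h∉W ∘ ∈ᵉ-reverse⁻ W ]′ ∘ ∈ᵉ-++⁻ before (reverseʷ W)) hb hu u≢b

      throughA : ∀ x → x ∈ʷ walk TA → TrailThrough x u h
      throughA x x∈ = TA , x∈ , there (∈ᵛ-++⁺ˡ W after (start∈walkVertices W)) , here refl
      throughB : ∀ x → x ∈ʷ walk TB → TrailThrough x u h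
      throughB x x∈ = TB , x∈ , here refl , here refl

      through : ∀ x → x ≡ inj₂ h ⊎ x ∈ʷ R → TrailThrough x u h
      through x (inj₁ refl) = throughA x (here refl)
      through x (inj₂ x∈R) =
        [ throughB x ∘ ∈ʷ-step⁺ x ∘ ∈ʷ-++⁺ˡ before (reverseʷ W) x
        , throughA x ∘ ∈ʷ-step⁺ x ∘ ∈ʷ-++⁺ʳ W after x ]′ (covers x x∈R)

  module _ (bypassable : ∀ g → Bypassable H g) where

    attachAtVertex : ∀ {t g u} (T : StrictClosedTrail H) x → x ∈ʷ walk T → t ∈ walkVertices (walk T) →
                     g ∉ walkEdges (walk T) → H g t ≡ true → H g u ≡ true → u ≢ t → TrailThrough x u g
    attachAtVertex {g = g} T x x∈T t∈T g∉T gt gu u≢t =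
      attachEar (bypassable g) R (trail (distinct T)) (g∉T ∘ edges⊆) gt gt gu u≢t u≢t
                x (inj₂ (elements x x∈T))
      where open ClosedRotation (rotateTo (walk T) t∈T)

    attachAtEdge : ∀ {h u} (T : StrictClosedTrail H) x → x ∈ʷ walk T → h ∈ walkEdges (walk T) →
                   H h u ≡ true → u ∉ walkVertices (walk T) → TrailThrough x u h
    attachAtEdge {h} T x x∈T h∈T hu u∉T =
      attachEar (bypassable h) R trail h∉R hc hd hu (λ { refl → u∉T c∈W }) (λ { refl → u∉T d∈W })
                x (elements x x∈T)
      where open OpenedAt (openAt (walk T) (distinct T) h∈T)

    stepOnto : ∀ {t q g} (T : StrictClosedTrail H) x → x ∈ʷ walk T → t ∈ walkVertices (walk T) →
               H g t ≡ true → H g q ≡ true → t ≢ q →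
               Σ (StrictClosedTrail H) λ T′ → x ∈ʷ walk T′ × q ∈ walkVertices (walk T′)
    stepOnto {q = q} {g} T x x∈T t∈T gt gq t≢q with q ∈ᵛ? walkVertices (walk T) | g ∈ᵉ? walkEdges (walk T)
    ... | yes q∈T | _       = T , x∈T , q∈T
    ... | no q∉T  | yes g∈T = let (T′ , x∈T′ , q∈T′ , _) = attachAtEdge T x x∈T g∈T gq q∉T
                              in T′ , x∈T′ , q∈T′
    ... | no _    | no g∉T  = let (T′ , x∈T′ , q∈T′ , _) = attachAtVertex T x x∈T t∈T g∉T gt gq (t≢q ∘ sym)
                              in T′ , x∈T′ , q∈T′

    reach : ∀ {t z} (T : StrictClosedTrail H) x → x ∈ʷ walk T → t ∈ walkVertices (walk T) → Walk H t z →
            Σ (StrictClosedTrail H) λ T′ → x ∈ʷ walk T′ × z ∈ walkVertices (walk T′)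
    reach T x x∈T t∈T []                      = T , x∈T , t∈T
    reach T x x∈T t∈T (step g t≢q gt gq P) with stepOnto T x x∈T t∈T gt gq t≢q
    ... | T′ , x∈T′ , q∈T′ = reach T′ x x∈T′ q∈T′ P

    nonemptyWalk⇒StrictClosedTrail : ∀ {u v} → Walk H u v → u ≢ v → StrictClosedTrail H
    nonemptyWalk⇒StrictClosedTrail [] u≢v = ⊥-elim (u≢v refl)
    nonemptyWalk⇒StrictClosedTrail (step g u≢w gu gw _) _ with bypassable g gw gu
    ... | B , g∉B with shortenToTrail B
    ...   | W , tW , W⊆B = closeWithEdge W tW (g∉B ∘ W⊆B) gw gu u≢w

    module _ (connected : Connected H) (edgeSize≥2 : ∀ e → 2 ≤ edgeSize H e) where

      extendThrough : (T : StrictClosedTrail H) → ∀ x → x ∈ʷ walk T → ∀ y →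
                      Σ (StrictClosedTrail H) λ T′ → x ∈ʷ walk T′ × y ∈ʷ walk T′
      extendThrough T x x∈T (inj₁ z) with start T ≟ z
      ... | yes refl = T , x∈T , start∈walkVertices (walk T)
      ... | no s≢z   = reach T x x∈T (start∈walkVertices (walk T)) (connected _ _ s≢z)
      extendThrough T x x∈T (inj₂ f) with count≥2⇒twoWitnesses (H f) (edgeSize≥2 f)
      ... | v , w , v≢w , fv , fw with extendThrough T x x∈T (inj₁ v)
      ...   | T₁ , x∈T₁ , v∈T₁ with f ∈ᵉ? walkEdges (walk T₁)
      ...     | yes f∈T₁ = T₁ , x∈T₁ , f∈T₁
      ...     | no f∉T₁ with attachAtVertex T₁ x x∈T₁ v∈T₁ f∉T₁ fv fw (v≢w ∘ sym)
      ...       | T₂ , x∈T₂ , _ , f∈T₂ = T₂ , x∈T₂ , f∈T₂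

  bypassAlongTrail : ∀ {p q} (T : StrictClosedTrail H) →
                     p ∈ walkVertices (walk T) → q ∈ walkVertices (walk T) → ∀ g → Bypass H g p q
  bypassAlongTrail T p∈T q∈T g with rotateTo (walk T) p∈T
  ... | record { R = R ; trail = trail ; elements = elements } with splitAtVertex R (elements (inj₁ _) q∈T)
  ...   | R₁ , R₂ , refl with g ∈ᵉ? walkEdges R₁
  ...     | no g∉R₁  = R₁ , g∉R₁
  ...     | yes g∈R₁ = reverseʷ R₂ ,
                       λ g∈ → IsTrail-++⇒Disjoint R₁ R₂ (trail (distinct T)) (g∈R₁ , ∈ᵉ-reverse⁻ R₂ g∈)

module _ {n m} (H : Hypergraph n m) where
  open Walks H
  open ClosedTrails H

  LieOnCommonTrails : {A : Set} → (A → StrictClosedTrail H → Set) → Set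
  LieOnCommonTrails {A} On = (x y : A) → x ≢ y → ∃ λ (T : StrictClosedTrail H) → On x T × On y T

  LieOnCommonTrails-restrict : ∀ {A B : Set} {OnA : A → StrictClosedTrail H → Set}
                               {OnB : B → StrictClosedTrail H → Set} (f : A → B) →
                               (∀ {x y} → f x ≡ f y → x ≡ y) → (∀ {x T} → OnB (f x) T → OnA x T) →
                               LieOnCommonTrails OnB → LieOnCommonTrails OnA
  LieOnCommonTrails-restrict f f-injective fromB common x y x≢y with common (f x) (f y) (x≢y ∘ f-injective)
  ... | T , x∈T , y∈T = T , fromB x∈T , fromB y∈T

  ∈ʷ⇒ElemOn : ∀ x (T : StrictClosedTrail H) → x ∈ʷ walk T → ElemOn x T
  ∈ʷ⇒ElemOn (inj₁ _) _ x∈T = x∈T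
  ∈ʷ⇒ElemOn (inj₂ _) _ x∈T = x∈T

  noCutEdges⇒elementsLieOnCommonTrails : 2 ≤ n → Connected H → (∀ e → 2 ≤ edgeSize H e) →
                                         NoCutEdges H → LieOnCommonTrails ElemOn
  noCutEdges⇒elementsLieOnCommonTrails 2≤n connected edgeSize≥2 noCut x y _ =
    let (u , v , u≢v)      = 2≤⇒distinct 2≤n
        T₀                 = nonemptyWalk⇒StrictClosedTrail bypassable (connected u v u≢v) u≢v
        (T₁ , _ , x∈T₁)    = through T₀ (inj₁ (start T₀)) (start∈walkVertices (walk T₀)) x
        (T₂ , x∈T₂ , y∈T₂) = through T₁ x x∈T₁ y
    in T₂ , ∈ʷ⇒ElemOn x T₂ x∈T₂ , ∈ʷ⇒ElemOn y T₂ y∈T₂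
    where
      bypassable = noCutEdges⇒bypassable connected noCut
      through    = extendThrough bypassable connected edgeSize≥2

  verticesLieOnCommonTrails⇒noCutEdges : LieOnCommonTrails VertexOn → NoCutEdges H
  verticesLieOnCommonTrails⇒noCutEdges common = bypassable⇒noCutEdges λ g {u} {t} _ _ → bypass g u t
    where
      bypass : ∀ g u t → Bypass H g u t
      bypass g u t with u ≟ t
      ... | yes refl = [] , λ ()
      ... | no u≢t with common u t u≢t
      ...   | T , u∈T , t∈T = bypassAlongTrail T u∈T t∈T g

  bypass-++ : ∀ {g u w v} → Bypass H g u w → Bypass H g w v → Bypass H g u v
  bypass-++ (A , g∉A) (B , g∉B) = A ++ʷ B , [ g∉A , g∉B ]′ ∘ ∈ᵉ-++⁻ A B

  bypassWithin : ∀ {f g u v} → f ≢ g → H f u ≡ true → H f v ≡ true → Bypass H g u v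
  bypassWithin {u = u} {v} f≢g fu fv with u ≟ v
  ... | yes refl = [] , λ ()
  ... | no u≢v   = step _ u≢v fu fv [] , λ { (here g≡f) → f≢g (sym g≡f) }

  degree≥2⇒otherEdge : (∀ v → 2 ≤ degree H v) → ∀ g u → Σ (Fin m) λ f → f ≢ g × H f u ≡ true
  degree≥2⇒otherEdge degree≥2 g u with count≥2⇒twoWitnesses (λ e → H e u) (degree≥2 u)
  ... | i , j , i≢j , iu , ju with i ≟ g
  ...   | yes refl = j , i≢j ∘ sym , ju
  ...   | no i≢g   = i , i≢g , iu

  ∈ᵉ⇒incidentVertex : ∀ {u v e} (W : Walk H u v) → e ∈ walkEdges W →
                      Σ (Fin n) λ p → p ∈ walkVertices W × H e p ≡ true
  ∈ᵉ⇒incidentVertex W e∈W with splitAtEdge W e∈W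
  ... | edgeSplit {c = c} _ ec _ A B refl = c , ∈ᵛ-++⁺ʳ A (step _ _ ec _ B) (here refl) , ec

  edgesLieOnCommonTrails⇒noCutEdges : (∀ v → 2 ≤ degree H v) → LieOnCommonTrails EdgeOn → NoCutEdges H
  edgesLieOnCommonTrails⇒noCutEdges degree≥2 common = bypassable⇒noCutEdges λ g {u} {t} _ _ → bypass g u t
    where
      bypass : ∀ g u t → Bypass H g u t
      bypass g u t with degree≥2⇒otherEdge degree≥2 g u | degree≥2⇒otherEdge degree≥2 g t
      ... | f , f≢g , fu | f′ , f′≢g , f′t with f ≟ f′
      ...   | yes refl = bypassWithin f≢g fu f′t
      ...   | no f≢f′ with common f f′ f≢f′
      ...     | T , f∈T , f′∈T with ∈ᵉ⇒incidentVertex (walk T) f∈T | ∈ᵉ⇒incidentVertex (walk T) f′∈T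
      ...       | p , p∈T , fp | q , q∈T , f′q =
        bypass-++ (bypassWithin f≢g fu fp)
                  (bypass-++ (bypassAlongTrail T p∈T q∈T g) (bypassWithin f′≢g f′q f′t))

theorem3p47 : (n m : ℕ) (H : Hypergraph n m) →
    2 ≤ n → Connected H →
    ((e : Fin m) → 2 ≤ edgeSize H e) →
    ((v : Fin n) → 2 ≤ degree H v) →
    (NoCutEdges H ⇔ ((x y : Fin n ⊎ Fin m) → x ≢ y →
        ∃ λ (T : StrictClosedTrail H) → ElemOn x T × ElemOn y T))
    × (NoCutEdges H ⇔ ((u v : Fin n) → u ≢ v →
        ∃ λ (T : StrictClosedTrail H) → VertexOn u T × VertexOn v T))
    × (NoCutEdges H ⇔ ((e f : Fin m) → e ≢ f →
        ∃ λ (T : StrictClosedTrail H) → EdgeOn e T × EdgeOn f T))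
theorem3p47 n m H 2≤n connected edgeSize≥2 degree≥2 =
  mk⇔ 1⇒2 (3⇒1 ∘ 2⇒3) , mk⇔ (2⇒3 ∘ 1⇒2) 3⇒1 , mk⇔ (2⇒4 ∘ 1⇒2) 4⇒1
  where
    1⇒2 = noCutEdges⇒elementsLieOnCommonTrails H 2≤n connected edgeSize≥2
    2⇒3 = LieOnCommonTrails-restrict H inj₁ inj₁-injective (λ v∈T → v∈T)
    2⇒4 = LieOnCommonTrails-restrict H inj₂ inj₂-injective (λ e∈T → e∈T)
    3⇒1 = verticesLieOnCommonTrails⇒noCutEdges H
    4⇒1 = edgesLieOnCommonTrails⇒noCutEdges H degree≥2
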